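{- Let $Z \subseteq \overline{\mathbb{F}}$ be a floating-point interval, and let $x \in \mathbb{F}^*$ and $z \in Z$. If $\beta^{e_{\min}} \le |z/x| \le \max\mathbb{F}$ and $\operatorname{diam}\mathrm{fl}^{ -1}[Z] \ge \beta^{Q(z)+1}$, then $x$ is feasible for $Z$.
   Context: Floating-point format: integers $\beta \ge 2$, $p \ge 1$, $e_{\min} \le e_{\max}$. $\mathbb{F}^* = \{M\beta^{e-p+1} : M,e \in \mathbb{Z},\ 0<|M|<\beta^p,\ e_{\min}\le e\le e_{\max}\}$, $\mathbb{F} = \mathbb{F}^*\cup\{0\}$, $\overline{\mathbb{F}} = \mathbb{F}\cup\{ -\infty,+\infty\}$. For real $x$: $E(x) = \lfloor \log_\beta |x|\rfloor$ if $|x| \ge \beta^{e_{\min}}$, else $E(x) = e_{\min}$; $Q(x) = E(x)-p+1$. $\mathrm{RD}(x) = \max\{y\in\overline{\mathbb{F}} : y \le x\}$, $\mathrm{RU}(x) = \min\{y \in \overline{\mathbb{F}} : y \ge x\}$. $\mathrm{fl}:\overline{\mathbb{R}}\to\overline{\mathbb{F}}$ is a fixed nondecreasing rounding function with $\mathrm{fl}(x)\in\{\mathrm{RD}(x),\mathrm{RU}(x)\}$ for all $x$; $x\otimes y = \mathrm{fl}(xy)$ whenever the product is defined. $\operatorname{diam} X = \sup(\{d(a,b): a,b\in X\}\cup\{0\})$ with $d(a,b)=0$ if $a=b$ and $|a-b|$ otherwise. A floating-point interval is a set $X\cap\overline{\mathbb{F}}$ with $X$ an extended-real interval. $x$ is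 feasible for $Z$ if $x\otimes y\in Z$ for some $y\in\overline{\mathbb{F}}$.
   Formalization: The rounding fl is defined on the extended rationals instead of $\overline{\mathbb{R}}$, so $\mathrm{fl}^{ -1}[Z]$ and its diameter are taken over them, and the interval X defining Z has extended-rational endpoints. -}

module Defs where

open import Data.Nat as ℕ using (ℕ; zero; suc)
open import Data.Nat.Properties using (m^n≢0)
open import Data.Integer as ℤ using (ℤ; +_; -[1+_])
open import Data.Rational as ℚ using (ℚ; 0ℚ; 1ℚ; _/_)
open import Data.Product using (Σ; ∃; _×_; _,_)
open import Data.Sum using (_⊎_)
open import Data.Maybe using (Maybe; just; nothing)
open import Data.Empty using (⊥)
open import Data.Unit using (⊤)
open import Relation.Nullary using (¬_; yes; no)
open import Relation.Binary.PropositionalEquality using (_≡_)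

data ℚ̄ : Set where
  -∞  : ℚ̄
  fin : ℚ → ℚ̄
  +∞  : ℚ̄

infix 4 _≤̄_ _<̄_

data _≤̄_ : ℚ̄ → ℚ̄ → Set where
  -∞≤     : ∀ {x} → -∞ ≤̄ x
  fin≤fin : ∀ {a b} → a ℚ.≤ b → fin a ≤̄ fin b
  ≤+∞     : ∀ {x} → x ≤̄ +∞

_<̄_ : ℚ̄ → ℚ̄ → Set
x <̄ y = x ≤̄ y × ¬ (x ≡ y)

dist : ℚ̄ → ℚ̄ → ℚ̄
dist -∞      -∞      = fin 0ℚ
dist -∞      (fin _) = +∞
dist -∞      +∞      = +∞
dist (fin a) -∞      = +∞
dist (fin a) (fin b) = fin ℚ.∣ a ℚ.- b ∣
dist (fin a) +∞      = +∞
dist +∞      -∞      = +∞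
dist +∞      (fin _) = +∞
dist +∞      +∞      = fin 0ℚ

-- Extended product, undefined (nothing) for 0 · (±∞).
data Sign : Set where
  neg zer pos : Sign

signℚ : ℚ → Sign
signℚ q with q ℚ.<? 0ℚ
... | yes _ = neg
... | no _ with q ℚ.≟ 0ℚ
...   | yes _ = zer
...   | no _  = pos

infty : Sign → Maybe ℚ̄
infty neg = just -∞
infty zer = nothing
infty pos = just +∞

flipS : Sign → Sign
flipS neg = pos
flipS zer = zer
flipS pos = neg

_·̄_ : ℚ̄ → ℚ̄ → Maybe ℚ̄
-∞    ·̄ -∞    = just +∞
-∞    ·̄ fin b = infty (flipS (signℚ b))
-∞    ·̄ +∞    = just -∞
fin a ·̄ -∞    = infty (flipS (signℚ a))
fin a ·̄ fin b = just (fin (a ℚ.* b))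
fin a ·̄ +∞    = infty (signℚ a)
+∞    ·̄ -∞    = just -∞
+∞    ·̄ fin b = infty (signℚ b)
+∞    ·̄ +∞    = just +∞

-- Integer powers of a natural base, as rationals.  (pow 0 k = 0 is junk;
-- it is only used with β ≥ 2.)

pow : ℕ → ℤ → ℚ
pow zero    k         = 0ℚ
pow (suc c) (+ n)     = (+ (suc c ℕ.^ n)) / 1
pow (suc c) -[1+ n ]  = (+ 1) / (suc c ℕ.^ suc n)
  where instance _ = m^n≢0 (suc c) (suc n)

record Format : Set where
  field
    β    : ℕ
    p    : ℕ
    emin : ℤ
    emax : ℤ
    2≤β       : 2 ℕ.≤ β
    1≤p       : 1 ℕ.≤ p
    emin≤emax : emin ℤ.≤ emax

module FP (fmt : Format) where
  open Format fmt

  β^ : ℤ → ℚ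
  β^ k = pow β k

  IsF* : ℚ → Set
  IsF* x = Σ ℤ λ M → Σ ℤ λ e →
             (0 ℕ.< ℤ.∣ M ∣) × (ℤ.∣ M ∣ ℕ.< β ℕ.^ p)
           × (emin ℤ.≤ e) × (e ℤ.≤ emax)
           × (x ≡ (M / 1) ℚ.* β^ (e ℤ.- (+ p) ℤ.+ (+ 1)))

  IsF : ℚ → Set
  IsF x = (x ≡ 0ℚ) ⊎ IsF* x

  IsF̄ : ℚ̄ → Set
  IsF̄ -∞      = ⊤
  IsF̄ (fin x) = IsF x
  IsF̄ +∞      = ⊤

  maxF : ℚ
  maxF = ((+ (β ℕ.^ p)) ℤ.- (+ 1)) / 1 ℚ.* β^ (emax ℤ.- (+ p) ℤ.+ (+ 1))

  -- E(x) = e  (as a relation; E is a function of x)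
  IsE : ℚ → ℤ → Set
  IsE x e = (β^ emin ℚ.≤ ℚ.∣ x ∣ × β^ e ℚ.≤ ℚ.∣ x ∣ × ℚ.∣ x ∣ ℚ.< β^ (e ℤ.+ (+ 1)))
          ⊎ (ℚ.∣ x ∣ ℚ.< β^ emin × e ≡ emin)

  -- Q(x) = E(x) - p + 1
  Qof : ℤ → ℤ
  Qof e = e ℤ.- (+ p) ℤ.+ (+ 1)

  IsRD : ℚ̄ → ℚ̄ → Set
  IsRD x y = IsF̄ y × y ≤̄ x × (∀ y′ → IsF̄ y′ → y′ ≤̄ x → y′ ≤̄ y)

  IsRU : ℚ̄ → ℚ̄ → Set
  IsRU x y = IsF̄ y × x ≤̄ y × (∀ y′ → IsF̄ y′ → x ≤̄ y′ → y ≤̄ y′)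

  record Rounding : Set where
    field
      fl       : ℚ̄ → ℚ̄
      mono     : ∀ {x y} → x ≤̄ y → fl x ≤̄ fl y
      faithful : ∀ x → IsRD x (fl x) ⊎ IsRU x (fl x)

  data Bound : Set where
    closed : ℚ̄ → Bound
    open′  : ℚ̄ → Bound

  AboveLo : Bound → ℚ̄ → Set
  AboveLo (closed a) x = a ≤̄ x
  AboveLo (open′ a)  x = a <̄ x

  BelowHi : Bound → ℚ̄ → Set
  BelowHi (closed b) x = x ≤̄ b
  BelowHi (open′ b)  x = x <̄ b

  FPInterval : Bound → Bound → ℚ̄ → Set
  FPInterval lo hi x = AboveLo lo x × BelowHi hi x × IsF̄ x

  -- diam S ≥ c  (for c > 0): sup of distances is ≥ c, i.e. every q < c is
  -- exceeded by some distance d(a,b) with a, b ∈ S.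
  DiamGe : (ℚ̄ → Set) → ℚ → Set
  DiamGe S c = ∀ q → q ℚ.< c → Σ ℚ̄ λ a → Σ ℚ̄ λ b → S a × S b × fin q <̄ dist a b

  module _ (R : Rounding) where
    open Rounding R

    Preimage : (ℚ̄ → Set) → ℚ̄ → Set
    Preimage Z w = Z (fl w)

    Feasible : (ℚ̄ → Set) → ℚ̄ → Set
    Feasible Z x = Σ ℚ̄ λ y → IsF̄ y × Σ ℚ̄ λ w → (x ·̄ y ≡ just w) × Z (fl w)

-- Total division on ℚ (value 0 when dividing by 0; only used with x ≠ 0).
_÷?_ : ℚ → ℚ → ℚ
a ÷? b with b ℚ.≟ 0ℚ
... | yes _ = 0ℚ
... | no b≢0 = a ℚ.÷ b
  where instance _ = ℚ.≢-nonZero b≢0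

{-# OPTIONS --safe #-}
module Submission where

-- Let s = z/x.  As β^emin ≤ |s| ≤ max 𝔽, s is in the normal range: for the k ∈ [emin, emax]
-- with β^k ≤ |s| < β^(k+1), s lies between two floats y₁ ≤ s ≤ y₂ at most β^(k-p+1) apart.
-- Hence x·y₁ and x·y₂ enclose z = x·s and are at most |x|·β^(k-p+1) apart, which is less than
-- β^(Q(z)+1) because |x|·β^k ≤ |z| < β^(E(z)+1).  As fl is monotone, fl⁻¹[Z] is convex; it
-- contains z and two points further apart than x·y₁ and x·y₂, so it contains one of them,
-- unless it contains ±∞, which is also a product x·(±∞).

open import Data.Nat as ℕ using (ℕ; zero; suc; z≤n; s≤s; z<s)
import Data.Nat.Properties as ℕP
open import Data.Integer as ℤ using (ℤ; +_; -[1+_])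
import Data.Integer.Properties as ℤP
open import Data.Integer.Solver renaming (module +-*-Solver to ℤSolver)
open import Data.Rational as ℚ using (ℚ; mkℚ; _/_; 0ℚ; 1ℚ)
import Data.Rational.Properties as ℚP
open import Data.Rational.Solver renaming (module +-*-Solver to ℚSolver)
open import Data.Rational.Unnormalised as ℚᵘ using (mkℚᵘ)
import Data.Rational.Unnormalised.Properties as ℚᵘP
import Data.Nat.Coprimality as Coprimality
open import Data.Product using (∃-syntax; _×_; _,_; proj₂)
open import Data.Sum using (_⊎_; inj₁; inj₂; [_,_]′)
open import Data.Unit using (tt)
open import Function using (_∘_; id)
open import Relation.Unary using (Pred; Decidable)
open import Relation.Nullary using (¬_; Dec; yes; no; contradiction)
open import Relation.Binary.PropositionalEquality

open import Defs

crossing : ∀ {p} {P : Pred ℕ p} → Decidable P → ∀ {m n} → m ℕ.≤ n → P m → ¬ P n →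
           ∃[ j ] m ℕ.≤ j × j ℕ.< n × P j × ¬ P (suc j)
crossing P? {n = zero} z≤n Pm ¬Pn = contradiction Pm ¬Pn
crossing P? {n = suc n} m≤1+n Pm ¬P1+n with ℕP.m≤n⇒m<n∨m≡n m≤1+n | P? n
... | inj₂ refl      | _      = contradiction Pm ¬P1+n
... | inj₁ (s≤s m≤n) | yes Pn = n , m≤n , ℕP.≤-refl , Pn , ¬P1+n
... | inj₁ (s≤s m≤n) | no ¬Pn with crossing P? m≤n Pm ¬Pn
...   | j , m≤j , j<n , Pj , ¬P1+j = j , m≤j , ℕP.m≤n⇒m≤1+n j<n , Pj , ¬P1+j

i+n+1≡i+[1+n] : ∀ i n → i ℤ.+ + n ℤ.+ + 1 ≡ i ℤ.+ + suc n
i+n+1≡i+[1+n] i n = trans (ℤP.+-assoc i (+ n) (+ 1)) (cong (λ m → i ℤ.+ + m) (ℕP.+-comm n 1))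

crossingℤ : ∀ {p} {P : Pred ℤ p} → Decidable P → ∀ {i k} → i ℤ.≤ k → P i → ¬ P k →
            ∃[ j ] i ℤ.≤ j × j ℤ.< k × P j × ¬ P (j ℤ.+ + 1)
crossingℤ {P = P} P? {i} {k} i≤k Pi ¬Pk =
  let n , _ , n<d , Pn , ¬P1+n = crossing (P? ∘ shift) z≤n (subst P (sym (ℤP.+-identityʳ i)) Pi)
                                          (¬Pk ∘ subst P i+d≡k)
  in shift n , ℤP.i≤i+j i (+ n) , subst (shift n ℤ.<_) i+d≡k (ℤP.+-monoʳ-< i (ℤ.+<+ n<d)) ,
     Pn , ¬P1+n ∘ subst P (i+n+1≡i+[1+n] i n)
  where
  open ≡-Reasoning
  shift : ℕ → ℤ
  shift n = i ℤ.+ + n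
  i+d≡k : shift ℤ.∣ k ℤ.- i ∣ ≡ k
  i+d≡k = begin
    i ℤ.+ + ℤ.∣ k ℤ.- i ∣  ≡⟨ cong (λ d → i ℤ.+ d) (ℤP.0≤i⇒+∣i∣≡i (ℤP.i≤j⇒0≤j-i i≤k)) ⟩
    i ℤ.+ (k ℤ.- i)        ≡⟨ solve 2 (λ i k → i :+ (k :- i) := k) refl i k ⟩
    k                      ∎
    where open ℤSolver

i<j+1⇒i≤j : ∀ {i j} → i ℤ.< j ℤ.+ + 1 → i ℤ.≤ j
i<j+1⇒i≤j {i} {j} i<j+1 = subst (i ℤ.≤_) (solve 1 (λ j → con -[1+ 0 ] :+ (j :+ con (+ 1)) := j) refl j)
                                (ℤP.i<j⇒i≤pred[j] i<j+1)
  where open ℤSolver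

toℚᵘ-/ : ∀ i m → ℚ.toℚᵘ (i / suc m) ℚᵘ.≃ mkℚᵘ i m
toℚᵘ-/ i m = ℚP.toℚᵘ-fromℚᵘ (mkℚᵘ i m)

*≡*⇒/≡/ : ∀ i j m n .{{_ : ℕ.NonZero m}} .{{_ : ℕ.NonZero n}} →
          i ℤ.* + n ≡ j ℤ.* + m → i / m ≡ j / n
*≡*⇒/≡/ i j (suc m) (suc n) eq = ℚP.toℚᵘ-injective
  (ℚᵘP.≃-trans (toℚᵘ-/ i m) (ℚᵘP.≃-trans (ℚᵘ.*≡* eq) (ℚᵘP.≃-sym (toℚᵘ-/ j n))))

/-*-/ : ∀ i j m n .{{_ : ℕ.NonZero m}} .{{_ : ℕ.NonZero n}} →
        (i / m) ℚ.* (j / n) ≡ ((i ℤ.* j) / (m ℕ.* n)) {{ℕP.m*n≢0 m n}}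
/-*-/ i j (suc m) (suc n) = ℚP.toℚᵘ-injective
  (ℚᵘP.≃-trans (ℚP.toℚᵘ-homo-* (i / suc m) (j / suc n))
  (ℚᵘP.≃-trans (ℚᵘP.*-cong (toℚᵘ-/ i m) (toℚᵘ-/ j n))
               (ℚᵘP.≃-sym (toℚᵘ-/ (i ℤ.* j) _))))

i/[m*n]*m≡i/n : ∀ i m n .{{_ : ℕ.NonZero m}} .{{_ : ℕ.NonZero n}} →
                (i / (m ℕ.* n)) {{ℕP.m*n≢0 m n}} ℚ.* (+ m / 1) ≡ i / n
i/[m*n]*m≡i/n i m n = begin
  (i / (m ℕ.* n)) ℚ.* (+ m / 1)    ≡⟨ /-*-/ i (+ m) (m ℕ.* n) 1 ⟩
  (i ℤ.* + m) / (m ℕ.* n ℕ.* 1)    ≡⟨ *≡*⇒/≡/ (i ℤ.* + m) i (m ℕ.* n ℕ.* 1) n cross ⟩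
  i / n                            ∎
  where
  open ≡-Reasoning
  instance
    m*n≢0 : ℕ.NonZero (m ℕ.* n)
    m*n≢0 = ℕP.m*n≢0 m n
    m*n*1≢0 : ℕ.NonZero (m ℕ.* n ℕ.* 1)
    m*n*1≢0 = ℕP.m*n≢0 (m ℕ.* n) 1
  cross : i ℤ.* + m ℤ.* + n ≡ i ℤ.* + (m ℕ.* n ℕ.* 1)
  cross = begin
    i ℤ.* + m ℤ.* + n          ≡⟨ ℤP.*-assoc i (+ m) (+ n) ⟩
    i ℤ.* (+ m ℤ.* + n)        ≡⟨ cong (i ℤ.*_) (ℤP.pos-* m n) ⟨
    i ℤ.* + (m ℕ.* n)          ≡⟨ cong (λ k → i ℤ.* + k) (ℕP.*-identityʳ (m ℕ.* n)) ⟨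
    i ℤ.* + (m ℕ.* n ℕ.* 1)    ∎

fromℤ : ℤ → ℚ
fromℤ i = i / 1

fromℤ≡mkℚ : ∀ i → fromℤ i ≡ mkℚ i 0 (Coprimality.sym (Coprimality.1-coprimeTo ℤ.∣ i ∣))
fromℤ≡mkℚ i = ℚP.toℚᵘ-injective (toℚᵘ-/ i 0)

fromℤ-* : ∀ i j → fromℤ (i ℤ.* j) ≡ fromℤ i ℚ.* fromℤ j
fromℤ-* i j = sym (/-*-/ i j 1 1)

fromℤ-+ : ∀ i j → fromℤ (i ℤ.+ j) ≡ fromℤ i ℚ.+ fromℤ j
fromℤ-+ i j = ℚP.toℚᵘ-injective (ℚᵘP.≃-trans (toℚᵘ-/ (i ℤ.+ j) 0) (ℚᵘP.≃-sym
  (ℚᵘP.≃-trans (ℚP.toℚᵘ-homo-+ (fromℤ i) (fromℤ j))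
  (ℚᵘP.≃-trans (ℚᵘP.+-cong (toℚᵘ-/ i 0) (toℚᵘ-/ j 0))
               (ℚᵘ.*≡* (cong (ℤ._* + 1) (cong₂ ℤ._+_ (ℤP.*-identityʳ i) (ℤP.*-identityʳ j))))))))

fromℤ-neg : ∀ i → fromℤ (ℤ.- i) ≡ ℚ.- fromℤ i
fromℤ-neg i = ℚP.toℚᵘ-injective (ℚᵘP.≃-trans (toℚᵘ-/ (ℤ.- i) 0) (ℚᵘP.≃-sym
  (ℚᵘP.≃-trans (ℚP.toℚᵘ-homo‿- (fromℤ i)) (ℚᵘP.-‿cong (toℚᵘ-/ i 0)))))

∣[1+m]*u-m*u∣≡u : ∀ m {u} → 0ℚ ℚ.≤ u → ℚ.∣ fromℤ (+ suc m) ℚ.* u ℚ.- fromℤ (+ m) ℚ.* u ∣ ≡ u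
∣[1+m]*u-m*u∣≡u m {u} 0≤u = begin
  ℚ.∣ fromℤ (+ suc m) ℚ.* u ℚ.- m′ ℚ.* u ∣  ≡⟨ cong (λ a → ℚ.∣ a ℚ.* u ℚ.- m′ ℚ.* u ∣) (fromℤ-+ (+ 1) (+ m)) ⟩
  ℚ.∣ (1ℚ ℚ.+ m′) ℚ.* u ℚ.- m′ ℚ.* u ∣      ≡⟨ cong ℚ.∣_∣ (solve 2 (λ a u → (con 1ℚ :+ a) :* u :- a :* u := u) refl m′ u) ⟩
  ℚ.∣ u ∣                                   ≡⟨ ℚP.0≤p⇒∣p∣≡p 0≤u ⟩
  u                                         ∎
  where open ≡-Reasoning
        open ℚSolver
        m′ = fromℤ (+ m)

fromℤ-mono-< : ∀ {i j} → i ℤ.< j → fromℤ i ℚ.< fromℤ j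
fromℤ-mono-< {i} {j} i<j rewrite fromℤ≡mkℚ i | fromℤ≡mkℚ j =
  ℚ.*<* (subst₂ ℤ._<_ (sym (ℤP.*-identityʳ i)) (sym (ℤP.*-identityʳ j)) i<j)

∣fromℤ∣ : ∀ i → ℚ.∣ fromℤ i ∣ ≡ fromℤ (+ ℤ.∣ i ∣)
∣fromℤ∣ i rewrite fromℤ≡mkℚ i | fromℤ≡mkℚ (+ ℤ.∣ i ∣) = refl

fromℤ-^-suc : ∀ b n → fromℤ (+ (b ℕ.^ suc n)) ≡ fromℤ (+ (b ℕ.^ n)) ℚ.* fromℤ (+ b)
fromℤ-^-suc b n = begin
  fromℤ (+ (b ℕ.* b ℕ.^ n))            ≡⟨ cong (fromℤ ∘ +_) (ℕP.*-comm b (b ℕ.^ n)) ⟩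
  fromℤ (+ (b ℕ.^ n ℕ.* b))            ≡⟨ cong fromℤ (ℤP.pos-* (b ℕ.^ n) b) ⟩
  fromℤ (+ (b ℕ.^ n) ℤ.* + b)          ≡⟨ fromℤ-* (+ (b ℕ.^ n)) (+ b) ⟩
  fromℤ (+ (b ℕ.^ n)) ℚ.* fromℤ (+ b)  ∎
  where open ≡-Reasoning

pow-+1 : ∀ b .{{_ : ℕ.NonZero b}} i → pow b (i ℤ.+ + 1) ≡ pow b i ℚ.* fromℤ (+ b)
pow-+1 b@(suc _) (+ n)        = trans (cong (λ k → fromℤ (+ (b ℕ.^ k))) (ℕP.+-comm n 1)) (fromℤ-^-suc b n)
pow-+1 b@(suc _) -[1+ 0 ]     = sym (i/[m*n]*m≡i/n (+ 1) b 1)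
pow-+1 b@(suc _) -[1+ suc n ] = sym (i/[m*n]*m≡i/n (+ 1) b (b ℕ.^ suc n) {{_}} {{ℕP.m^n≢0 b (suc n)}})

pow-+-ℕ : ∀ b .{{_ : ℕ.NonZero b}} i n → pow b (i ℤ.+ + n) ≡ pow b i ℚ.* fromℤ (+ (b ℕ.^ n))
pow-+-ℕ b i zero    = trans (cong (pow b) (ℤP.+-identityʳ i)) (sym (ℚP.*-identityʳ (pow b i)))
pow-+-ℕ b i (suc n) = begin
  pow b (i ℤ.+ + suc n)                              ≡⟨ cong (pow b) (i+n+1≡i+[1+n] i n) ⟨
  pow b ((i ℤ.+ + n) ℤ.+ + 1)                        ≡⟨ pow-+1 b (i ℤ.+ + n) ⟩
  pow b (i ℤ.+ + n) ℚ.* fromℤ (+ b)                  ≡⟨ cong (ℚ._* fromℤ (+ b)) (pow-+-ℕ b i n) ⟩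
  pow b i ℚ.* fromℤ (+ (b ℕ.^ n)) ℚ.* fromℤ (+ b)    ≡⟨ ℚP.*-assoc (pow b i) _ _ ⟩
  pow b i ℚ.* (fromℤ (+ (b ℕ.^ n)) ℚ.* fromℤ (+ b))  ≡⟨ cong (pow b i ℚ.*_) (fromℤ-^-suc b n) ⟨
  pow b i ℚ.* fromℤ (+ (b ℕ.^ suc n))                ∎
  where open ≡-Reasoning

pow-pos : ∀ b .{{_ : ℕ.NonZero b}} i → 0ℚ ℚ.< pow b i
pow-pos b@(suc _) (+ n)    = fromℤ-mono-< (ℤ.+<+ (ℕP.m^n>0 b n))
pow-pos b@(suc _) -[1+ n ] = ℚP.positive⁻¹ _ {{ℚP.normalize-pos 1 (b ℕ.^ suc n) {{ℕP.m^n≢0 b (suc n)}}}}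

<⇒≱ : ∀ {p q} → p ℚ.< q → ¬ q ℚ.≤ p
<⇒≱ p<q q≤p = ℚP.<-irrefl refl (ℚP.<-≤-trans p<q q≤p)

p≤q⇒∣q-p∣≡q-p : ∀ {p q} → p ℚ.≤ q → ℚ.∣ q ℚ.- p ∣ ≡ q ℚ.- p
p≤q⇒∣q-p∣≡q-p {p} {q} p≤q =
  ℚP.0≤p⇒∣p∣≡p (subst (ℚ._≤ q ℚ.- p) (ℚP.+-inverseʳ p) (ℚP.+-monoˡ-≤ (ℚ.- p) p≤q))

∣p-q∣≡∣q-p∣ : ∀ p q → ℚ.∣ p ℚ.- q ∣ ≡ ℚ.∣ q ℚ.- p ∣
∣p-q∣≡∣q-p∣ p q = trans (cong ℚ.∣_∣ (solve 2 (λ p q → p :- q := :- (q :- p)) refl p q)) (ℚP.∣-p∣≡∣p∣ (q ℚ.- p))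
  where open ℚSolver

∣r*q-r*p∣≤∣r∣*δ : ∀ r {p q δ} → ℚ.∣ q ℚ.- p ∣ ℚ.≤ δ → ℚ.∣ r ℚ.* q ℚ.- r ℚ.* p ∣ ℚ.≤ ℚ.∣ r ∣ ℚ.* δ
∣r*q-r*p∣≤∣r∣*δ r {p} {q} {δ} gap = begin
  ℚ.∣ r ℚ.* q ℚ.- r ℚ.* p ∣   ≡⟨ cong ℚ.∣_∣ (solve 3 (λ r p q → r :* q :- r :* p := r :* (q :- p)) refl r p q) ⟩
  ℚ.∣ r ℚ.* (q ℚ.- p) ∣       ≡⟨ ℚP.∣p*q∣≡∣p∣*∣q∣ r (q ℚ.- p) ⟩
  ℚ.∣ r ∣ ℚ.* ℚ.∣ q ℚ.- p ∣   ≤⟨ ℚP.*-monoˡ-≤-nonNeg ℚ.∣ r ∣ {{ℚP.∣-∣-nonNeg r}} gap ⟩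
  ℚ.∣ r ∣ ℚ.* δ               ∎
  where open ℚP.≤-Reasoning
        open ℚSolver

≤∧≢⇒< : ∀ {p q} → p ℚ.≤ q → p ≢ q → p ℚ.< q
≤∧≢⇒< p≤q p≢q = ℚP.≰⇒> (λ q≤p → p≢q (ℚP.≤-antisym p≤q q≤p))

x*[z÷?x]≡z : ∀ {x} z → x ≢ 0ℚ → x ℚ.* (z ÷? x) ≡ z
x*[z÷?x]≡z {x} z x≢0 with x ℚ.≟ 0ℚ
... | yes x≡0 = contradiction x≡0 x≢0
... | no x≢0′ = begin
  x ℚ.* (z ℚ.* ℚ.1/ x)   ≡⟨ ℚP.*-comm x _ ⟩
  z ℚ.* ℚ.1/ x ℚ.* x     ≡⟨ ℚP.*-assoc z _ x ⟩
  z ℚ.* (ℚ.1/ x ℚ.* x)   ≡⟨ cong (z ℚ.*_) (ℚP.*-inverseˡ x) ⟩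
  z ℚ.* 1ℚ               ≡⟨ ℚP.*-identityʳ z ⟩
  z                      ∎
  where open ≡-Reasoning
        instance _ = ℚ.≢-nonZero x≢0′

Convex : ∀ {ℓ} → Pred ℚ ℓ → Set ℓ
Convex T = ∀ {u v w} → u ℚ.≤ v → v ℚ.≤ w → T u → T w → T v

module _ {ℓ} {T : Pred ℚ ℓ} (convex : Convex T)
         {z y y′ : ℚ} (Tz : T z) (y≤z : y ℚ.≤ z) (z≤y′ : z ℚ.≤ y′) where

  convex-bracket-≤ : ∀ {a b} → a ℚ.≤ b → T a → T b → y′ ℚ.- y ℚ.< b ℚ.- a → T y ⊎ T y′
  convex-bracket-≤ {a} {b} a≤b Ta Tb gap with a ℚ.≤? y
  ... | yes a≤y = inj₁ (convex a≤y y≤z Ta Tz)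
  ... | no a≰y  = inj₂ (convex z≤y′ (ℚP.<⇒≤ y′<b) Tz Tb)
    where
    y′<b : y′ ℚ.< b
    y′<b = subst₂ ℚ._<_ (solve 2 (λ y y′ → (y′ :- y) :+ y := y′) refl y y′)
                        (solve 2 (λ a b → (b :- a) :+ a := b) refl a b)
                        (ℚP.+-mono-< gap (ℚP.≰⇒> a≰y))
      where open ℚSolver

  private
    ∣y′-y∣≡y′-y : ℚ.∣ y′ ℚ.- y ∣ ≡ y′ ℚ.- y
    ∣y′-y∣≡y′-y = p≤q⇒∣q-p∣≡q-p (ℚP.≤-trans y≤z z≤y′)

  convex-bracket : ∀ {a b} → T a → T b → ℚ.∣ y′ ℚ.- y ∣ ℚ.< ℚ.∣ a ℚ.- b ∣ → T y ⊎ T y′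
  convex-bracket {a} {b} Ta Tb gap with ℚP.≤-total a b
  ... | inj₁ a≤b = convex-bracket-≤ a≤b Ta Tb
                     (subst₂ ℚ._<_ ∣y′-y∣≡y′-y (trans (∣p-q∣≡∣q-p∣ a b) (p≤q⇒∣q-p∣≡q-p a≤b)) gap)
  ... | inj₂ b≤a = convex-bracket-≤ b≤a Tb Ta (subst₂ ℚ._<_ ∣y′-y∣≡y′-y (p≤q⇒∣q-p∣≡q-p b≤a) gap)

≤̄-refl : ∀ {x} → x ≤̄ x
≤̄-refl { -∞}   = -∞≤
≤̄-refl {fin _} = fin≤fin ℚP.≤-refl
≤̄-refl {+∞}    = ≤+∞

≤̄-trans : ∀ {x y w} → x ≤̄ y → y ≤̄ w → x ≤̄ w
≤̄-trans -∞≤           _             = -∞≤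
≤̄-trans (fin≤fin x≤y) (fin≤fin y≤w) = fin≤fin (ℚP.≤-trans x≤y y≤w)
≤̄-trans (fin≤fin _)   ≤+∞           = ≤+∞
≤̄-trans ≤+∞           ≤+∞           = ≤+∞

≤̄-antisym : ∀ {x y} → x ≤̄ y → y ≤̄ x → x ≡ y
≤̄-antisym -∞≤           -∞≤           = refl
≤̄-antisym (fin≤fin x≤y) (fin≤fin y≤x) = cong fin (ℚP.≤-antisym x≤y y≤x)
≤̄-antisym ≤+∞           ≤+∞           = refl

signℚ≡zer⇒≡0 : ∀ q → signℚ q ≡ zer → q ≡ 0ℚ
signℚ≡zer⇒≡0 q eq with q ℚ.<? 0ℚ
signℚ≡zer⇒≡0 q () | yes _
... | no _ with q ℚ.≟ 0ℚ
...   | yes q≡0 = q≡0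
signℚ≡zer⇒≡0 q () | no _ | no _

module FPProperties (fmt : Format) where
  open Format fmt
  open FP fmt

  instance
    β≢0 : ℕ.NonZero β
    β≢0 = ℕ.>-nonZero (ℕP.<-≤-trans (s≤s z≤n) 2≤β)

  ulp : ℤ → ℚ
  ulp e = β^ (Qof e)

  β^≡β^[p-1]*ulp : ∀ j → β^ j ≡ fromℤ (+ (β ℕ.^ ℕ.pred p)) ℚ.* ulp j
  β^≡β^[p-1]*ulp j = begin
    β^ j                                  ≡⟨ cong β^ (solve 2 (λ j p → j := (j :- p :+ con (+ 1)) :+ (p :- con (+ 1))) refl j (+ p)) ⟩
    β^ (Qof j ℤ.+ (+ p ℤ.- + 1))          ≡⟨ cong (λ i → β^ (Qof j ℤ.+ i)) (ℤP.⊖-≥ 1≤p) ⟩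
    β^ (Qof j ℤ.+ + ℕ.pred p)             ≡⟨ pow-+-ℕ β (Qof j) (ℕ.pred p) ⟩
    ulp j ℚ.* fromℤ (+ (β ℕ.^ ℕ.pred p))  ≡⟨ ℚP.*-comm (ulp j) _ ⟩
    fromℤ (+ (β ℕ.^ ℕ.pred p)) ℚ.* ulp j  ∎
    where open ≡-Reasoning
          open ℤSolver

  β^[1+j]≡β^p*ulp : ∀ j → β^ (j ℤ.+ + 1) ≡ fromℤ (+ (β ℕ.^ p)) ℚ.* ulp j
  β^[1+j]≡β^p*ulp j = begin
    β^ (j ℤ.+ + 1)                 ≡⟨ cong β^ (solve 2 (λ j p → j :+ con (+ 1) := (j :- p :+ con (+ 1)) :+ p) refl j (+ p)) ⟩
    β^ (Qof j ℤ.+ + p)             ≡⟨ pow-+-ℕ β (Qof j) p ⟩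
    ulp j ℚ.* fromℤ (+ (β ℕ.^ p))  ≡⟨ ℚP.*-comm (ulp j) _ ⟩
    fromℤ (+ (β ℕ.^ p)) ℚ.* ulp j  ∎
    where open ≡-Reasoning
          open ℤSolver

  IsF-grid : ∀ {M k} → 0 ℕ.< M → M ℕ.< β ℕ.^ p → emin ℤ.≤ k → k ℤ.≤ emax → IsF (fromℤ (+ M) ℚ.* ulp k)
  IsF-grid {M} {k} 0<M M<β^p emin≤k k≤emax = inj₂ (+ M , k , 0<M , M<β^p , emin≤k , k≤emax , refl)

  IsF-β^ : ∀ {k} → emin ℤ.≤ k → k ℤ.≤ emax → IsF (β^ k)
  IsF-β^ {k} emin≤k k≤emax = subst IsF (sym (β^≡β^[p-1]*ulp k))
    (IsF-grid (ℕP.m^n>0 β (ℕ.pred p)) (ℕP.^-monoʳ-< β 2≤β pred[p]<p) emin≤k k≤emax)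
    where pred[p]<p = ℕP.≤-reflexive (ℕP.suc-pred p {{ℕ.>-nonZero 1≤p}})

  IsF-neg : ∀ {y} → IsF y → IsF (ℚ.- y)
  IsF-neg (inj₁ refl) = inj₁ refl
  IsF-neg (inj₂ (M , e , 0<∣M∣ , ∣M∣<β^p , emin≤e , e≤emax , refl)) =
    inj₂ (ℤ.- M , e , subst (0 ℕ.<_) ∣-M∣ 0<∣M∣ , subst (ℕ._< β ℕ.^ p) ∣-M∣ ∣M∣<β^p , emin≤e , e≤emax ,
          trans (ℚP.neg-distribˡ-* (fromℤ M) (ulp e)) (cong (ℚ._* ulp e) (sym (fromℤ-neg M))))
    where ∣-M∣ = sym (ℤP.∣-i∣≡∣i∣ M)

  FloatBracket : (ℚ → ℚ) → ℚ → ℚ → Set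
  FloatBracket f δ t = ∃[ y₁ ] ∃[ y₂ ] IsF y₁ × IsF y₂ × f y₁ ℚ.≤ t × t ℚ.≤ f y₂ × ℚ.∣ f y₂ ℚ.- f y₁ ∣ ℚ.≤ δ

  bracket-neg : ∀ {δ t} → FloatBracket id δ t → FloatBracket id δ (ℚ.- t)
  bracket-neg (y₁ , y₂ , F₁ , F₂ , y₁≤t , t≤y₂ , gap) =
    ℚ.- y₂ , ℚ.- y₁ , IsF-neg F₂ , IsF-neg F₁ , ℚP.neg-antimono-≤ t≤y₂ , ℚP.neg-antimono-≤ y₁≤t ,
    subst (ℚ._≤ _) (cong ℚ.∣_∣ (solve 2 (λ y₁ y₂ → y₂ :- y₁ := (:- y₁) :- (:- y₂)) refl y₁ y₂)) gap
    where open ℚSolver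

  bracket-from-∣∣ : ∀ {δ t} → FloatBracket id δ ℚ.∣ t ∣ → FloatBracket id δ t
  bracket-from-∣∣ {δ} {t} br with ℚP.∣p∣≡p∨∣p∣≡-p t
  ... | inj₁ ∣t∣≡t  = subst (FloatBracket id δ) ∣t∣≡t br
  ... | inj₂ ∣t∣≡-t = subst (FloatBracket id δ) (trans (cong ℚ.-_ ∣t∣≡-t) (solve 1 (λ t → :- (:- t) := t) refl t))
                            (bracket-neg br)
    where open ℚSolver

  bracket-scale : ∀ r {δ t} → FloatBracket id δ t → FloatBracket (r ℚ.*_) (ℚ.∣ r ∣ ℚ.* δ) (r ℚ.* t)
  bracket-scale r (y₁ , y₂ , F₁ , F₂ , y₁≤t , t≤y₂ , gap) with ℚP.≤-total 0ℚ r
  ... | inj₁ 0≤r = y₁ , y₂ , F₁ , F₂ , ℚP.*-monoˡ-≤-nonNeg r y₁≤t , ℚP.*-monoˡ-≤-nonNeg r t≤y₂ ,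
                   ∣r*q-r*p∣≤∣r∣*δ r gap
    where instance _ = ℚ.nonNegative 0≤r
  ... | inj₂ r≤0 = y₂ , y₁ , F₂ , F₁ , ℚP.*-monoˡ-≤-nonPos r t≤y₂ , ℚP.*-monoˡ-≤-nonPos r y₁≤t ,
                   subst (ℚ._≤ _) (∣p-q∣≡∣q-p∣ (r ℚ.* y₂) (r ℚ.* y₁)) (∣r*q-r*p∣≤∣r∣*δ r gap)
    where instance _ = ℚ.nonPositive r≤0

  0<ulp : ∀ e → 0ℚ ℚ.< ulp e
  0<ulp e = pow-pos β (Qof e)

  maxF<β^[emax+1] : maxF ℚ.< β^ (emax ℤ.+ + 1)
  maxF<β^[emax+1] = subst (maxF ℚ.<_) (sym (β^[1+j]≡β^p*ulp emax))
    (ℚP.*-monoˡ-<-pos (ulp emax) {{ℚ.positive (0<ulp emax)}} (fromℤ-mono-< (ℤP.m⊖1+n<m (β ℕ.^ p) 1)))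

  exponent-of : ∀ {t} → β^ emin ℚ.≤ t → t ℚ.≤ maxF →
                ∃[ k ] emin ℤ.≤ k × k ℤ.≤ emax × β^ k ℚ.≤ t × t ℚ.< β^ (k ℤ.+ + 1)
  exponent-of {t} β^emin≤t t≤maxF =
    let k , emin≤k , k<emax+1 , β^k≤t , β^[k+1]≰t =
          crossingℤ (λ j → β^ j ℚ.≤? t) (ℤP.≤-trans emin≤emax (ℤP.i≤i+j emax (+ 1))) β^emin≤t
                    (<⇒≱ (ℚP.≤-<-trans t≤maxF maxF<β^[emax+1]))
    in k , emin≤k , i<j+1⇒i≤j k<emax+1 , β^k≤t , ℚP.≰⇒> β^[k+1]≰t

  mantissa-of : ∀ {k t} → β^ k ℚ.≤ t → t ℚ.< β^ (k ℤ.+ + 1) →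
                ∃[ M ] β ℕ.^ ℕ.pred p ℕ.≤ M × M ℕ.< β ℕ.^ p ×
                       fromℤ (+ M) ℚ.* ulp k ℚ.≤ t × t ℚ.< fromℤ (+ suc M) ℚ.* ulp k
  mantissa-of {k} {t} β^k≤t t<β^[k+1] =
    let M , β^[p-1]≤M , M<β^p , y₁≤t , y₁+ulp≰t =
          crossing (λ M → fromℤ (+ M) ℚ.* ulp k ℚ.≤? t) (ℕP.^-monoʳ-≤ β (ℕP.pred[n]≤n {p}))
                   (subst (ℚ._≤ t) (β^≡β^[p-1]*ulp k) β^k≤t)
                   (<⇒≱ (subst (t ℚ.<_) (β^[1+j]≡β^p*ulp k) t<β^[k+1]))
    in M , β^[p-1]≤M , M<β^p , y₁≤t , ℚP.≰⇒> y₁+ulp≰t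

  -- (M+1)·ulp k is a float unless M + 1 = β^p; then it is β^(k+1), a float if k < emax,
  -- while for k = emax the bound t ≤ max 𝔽 = M·ulp k lets y₁ serve on both sides.
  grid-bracket : ∀ {k M t} → emin ℤ.≤ k → k ℤ.≤ emax → 0 ℕ.< M → M ℕ.< β ℕ.^ p →
                 fromℤ (+ M) ℚ.* ulp k ℚ.≤ t → t ℚ.< fromℤ (+ suc M) ℚ.* ulp k → t ℚ.≤ maxF →
                 FloatBracket id (ulp k) t
  grid-bracket {k} {M} {t} emin≤k k≤emax 0<M M<β^p y₁≤t t<y₂ t≤maxF =
    choose (suc M ℕ.<? β ℕ.^ p) (k ℤ.<? emax)
    where
    y₁ y₂ : ℚ
    y₁ = fromℤ (+ M) ℚ.* ulp k
    y₂ = fromℤ (+ suc M) ℚ.* ulp k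
    F₁ : IsF y₁
    F₁ = IsF-grid 0<M M<β^p emin≤k k≤emax
    gap : ℚ.∣ y₂ ℚ.- y₁ ∣ ℚ.≤ ulp k
    gap = ℚP.≤-reflexive (∣[1+m]*u-m*u∣≡u M (ℚP.<⇒≤ (0<ulp k)))
    1+M≡β^p : ¬ suc M ℕ.< β ℕ.^ p → suc M ≡ β ℕ.^ p
    1+M≡β^p 1+M≮β^p = ℕP.≤-antisym M<β^p (ℕP.≮⇒≥ 1+M≮β^p)
    choose : Dec (suc M ℕ.< β ℕ.^ p) → Dec (k ℤ.< emax) → FloatBracket id (ulp k) t
    choose (yes 1+M<β^p) _ = y₁ , y₂ , F₁ , IsF-grid z<s 1+M<β^p emin≤k k≤emax , y₁≤t , ℚP.<⇒≤ t<y₂ , gap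
    choose (no 1+M≮β^p) (yes k<emax) =
      y₁ , y₂ , F₁ , subst IsF β^[k+1]≡y₂ (IsF-β^ (ℤP.≤-trans emin≤k (ℤP.i≤i+j k (+ 1))) k+1≤emax) ,
      y₁≤t , ℚP.<⇒≤ t<y₂ , gap
      where
      β^[k+1]≡y₂ : β^ (k ℤ.+ + 1) ≡ y₂
      β^[k+1]≡y₂ = trans (β^[1+j]≡β^p*ulp k) (cong (λ n → fromℤ (+ n) ℚ.* ulp k) (sym (1+M≡β^p 1+M≮β^p)))
      k+1≤emax : k ℤ.+ + 1 ℤ.≤ emax
      k+1≤emax = subst (ℤ._≤ emax) (ℤP.+-comm (+ 1) k) (ℤP.i<j⇒suc[i]≤j k<emax)
    choose (no 1+M≮β^p) (no k≮emax) =
      y₁ , y₁ , F₁ , F₁ , y₁≤t , subst (t ℚ.≤_) maxF≡y₁ t≤maxF ,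
      subst (ℚ._≤ ulp k) (cong ℚ.∣_∣ (sym (ℚP.+-inverseʳ y₁))) (ℚP.<⇒≤ (0<ulp k))
      where
      maxF≡y₁ : maxF ≡ y₁
      maxF≡y₁ rewrite sym (1+M≡β^p 1+M≮β^p) | ℤP.≤-antisym k≤emax (ℤP.≮⇒≥ k≮emax) = refl

  normal-bracket : ∀ {t} → β^ emin ℚ.≤ t → t ℚ.≤ maxF → ∃[ k ] β^ k ℚ.≤ t × FloatBracket id (ulp k) t
  normal-bracket β^emin≤t t≤maxF =
    let k , emin≤k , k≤emax , β^k≤t , t<β^[k+1] = exponent-of β^emin≤t t≤maxF
        M , β^[p-1]≤M , M<β^p , y₁≤t , t<y₂ = mantissa-of β^k≤t t<β^[k+1]
    in k , β^k≤t ,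
       grid-bracket emin≤k k≤emax (ℕP.<-≤-trans (ℕP.m^n>0 β (ℕ.pred p)) β^[p-1]≤M) M<β^p y₁≤t t<y₂ t≤maxF

  β^<β^[j+1] : ∀ j → β^ j ℚ.< β^ (j ℤ.+ + 1)
  β^<β^[j+1] j = begin-strict
    β^ j                              ≡⟨ ℚP.*-identityʳ (β^ j) ⟨
    β^ j ℚ.* 1ℚ                       <⟨ ℚP.*-monoʳ-<-pos (β^ j) {{ℚ.positive (pow-pos β j)}} (fromℤ-mono-< (ℤ.+<+ 1<β¹)) ⟩
    β^ j ℚ.* fromℤ (+ (β ℕ.^ 1))      ≡⟨ pow-+-ℕ β j 1 ⟨
    β^ (j ℤ.+ + 1)                    ∎
    where open ℚP.≤-Reasoning
          1<β¹ = subst (1 ℕ.<_) (sym (ℕP.*-identityʳ β)) 2≤β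

  IsE⇒∣x∣<β^[e+1] : ∀ {x e} → IsE x e → ℚ.∣ x ∣ ℚ.< β^ (e ℤ.+ + 1)
  IsE⇒∣x∣<β^[e+1] (inj₁ (_ , _ , ∣x∣<β^[e+1])) = ∣x∣<β^[e+1]
  IsE⇒∣x∣<β^[e+1] (inj₂ (∣x∣<β^emin , refl))    = ℚP.<-trans ∣x∣<β^emin (β^<β^[j+1] emin)

  Qof[e+1]≡Qof[e]+1 : ∀ e → Qof (e ℤ.+ + 1) ≡ Qof e ℤ.+ + 1
  Qof[e+1]≡Qof[e]+1 e =
    solve 2 (λ e p → e :+ con (+ 1) :- p :+ con (+ 1) := e :- p :+ con (+ 1) :+ con (+ 1)) refl e (+ p)
    where open ℤSolver

  ∣x∣*ulp<β^[Q+1] : ∀ x {s k} e → β^ k ℚ.≤ ℚ.∣ s ∣ → ℚ.∣ x ℚ.* s ∣ ℚ.< β^ (e ℤ.+ + 1) →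
                    ℚ.∣ x ∣ ℚ.* ulp k ℚ.< β^ (Qof e ℤ.+ + 1)
  ∣x∣*ulp<β^[Q+1] x {s} {k} e β^k≤∣s∣ ∣xs∣<β^[e+1] = ℚP.*-cancelˡ-<-nonNeg B (begin-strict
    B ℚ.* (ℚ.∣ x ∣ ℚ.* ulp k)  ≡⟨ solve 3 (λ B a u → B :* (a :* u) := a :* (B :* u)) refl B ℚ.∣ x ∣ (ulp k) ⟩
    ℚ.∣ x ∣ ℚ.* (B ℚ.* ulp k)  ≡⟨ cong (ℚ.∣ x ∣ ℚ.*_) (β^≡β^[p-1]*ulp k) ⟨
    ℚ.∣ x ∣ ℚ.* β^ k           ≤⟨ ℚP.*-monoˡ-≤-nonNeg ℚ.∣ x ∣ {{ℚP.∣-∣-nonNeg x}} β^k≤∣s∣ ⟩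
    ℚ.∣ x ∣ ℚ.* ℚ.∣ s ∣        ≡⟨ ℚP.∣p*q∣≡∣p∣*∣q∣ x s ⟨
    ℚ.∣ x ℚ.* s ∣              <⟨ ∣xs∣<β^[e+1] ⟩
    β^ (e ℤ.+ + 1)             ≡⟨ β^≡β^[p-1]*ulp (e ℤ.+ + 1) ⟩
    B ℚ.* ulp (e ℤ.+ + 1)      ≡⟨ cong (λ i → B ℚ.* β^ i) (Qof[e+1]≡Qof[e]+1 e) ⟩
    B ℚ.* β^ (Qof e ℤ.+ + 1)   ∎)
    where
    open ℚP.≤-Reasoning
    open ℚSolver
    B = fromℤ (+ (β ℕ.^ ℕ.pred p))
    instance
      B≥0 : ℚ.NonNegative B
      B≥0 = ℚ.nonNegative (ℚP.<⇒≤ (fromℤ-mono-< (ℤ.+<+ (ℕP.m^n>0 β (ℕ.pred p)))))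

  IsF*⇒≢0 : ∀ {x} → IsF* x → x ≢ 0ℚ
  IsF*⇒≢0 (M , e , 0<∣M∣ , _ , _ , _ , refl) x≡0 = ℚP.<-irrefl (sym (cong ℚ.∣_∣ x≡0)) (begin-strict
    0ℚ                              <⟨ ℚP.positive⁻¹ _ {{ℚP.pos*pos⇒pos (fromℤ (+ ℤ.∣ M ∣)) (ulp e)}} ⟩
    fromℤ (+ ℤ.∣ M ∣) ℚ.* ulp e     ≡⟨ cong₂ ℚ._*_ (∣fromℤ∣ M) (ℚP.0≤p⇒∣p∣≡p (ℚP.<⇒≤ (0<ulp e))) ⟨
    ℚ.∣ fromℤ M ∣ ℚ.* ℚ.∣ ulp e ∣   ≡⟨ ℚP.∣p*q∣≡∣p∣*∣q∣ (fromℤ M) (ulp e) ⟨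
    ℚ.∣ fromℤ M ℚ.* ulp e ∣         ∎)
    where
    open ℚP.≤-Reasoning
    instance
      ∣M∣>0 : ℚ.Positive (fromℤ (+ ℤ.∣ M ∣))
      ∣M∣>0 = ℚ.positive (fromℤ-mono-< (ℤ.+<+ 0<∣M∣))
      ulp>0 : ℚ.Positive (ulp e)
      ulp>0 = ℚ.positive (0<ulp e)

  AboveLo-mono : ∀ lo {a b} → AboveLo lo a → a ≤̄ b → AboveLo lo b
  AboveLo-mono (closed c) c≤a a≤b         = ≤̄-trans c≤a a≤b
  AboveLo-mono (open′ c)  (c≤a , c≢a) a≤b = ≤̄-trans c≤a a≤b , λ { refl → c≢a (≤̄-antisym c≤a a≤b) }

  BelowHi-mono : ∀ hi {a b} → BelowHi hi b → a ≤̄ b → BelowHi hi a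
  BelowHi-mono (closed c) b≤c a≤b         = ≤̄-trans a≤b b≤c
  BelowHi-mono (open′ c)  (b≤c , b≢c) a≤b = ≤̄-trans a≤b b≤c , λ { refl → b≢c (≤̄-antisym b≤c a≤b) }

  module _ (R : Rounding) where
    open Rounding R

    IsF̄-fl : ∀ w → IsF̄ (fl w)
    IsF̄-fl w with faithful w
    ... | inj₁ (F , _) = F
    ... | inj₂ (F , _) = F

    fl-fixed : ∀ {y} → IsF̄ y → fl y ≡ y
    fl-fixed {y} F with faithful y
    ... | inj₁ (_ , fl≤y , greatest) = ≤̄-antisym fl≤y (greatest y F ≤̄-refl)
    ... | inj₂ (_ , y≤fl , least)    = sym (≤̄-antisym y≤fl (least y F ≤̄-refl))

    Preimage-convex : ∀ lo hi → Convex (λ q → Preimage R (FPInterval lo hi) (fin q))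
    Preimage-convex lo hi u≤v v≤w (lo≤fl[u] , _ , _) (_ , fl[w]≤hi , _) =
      AboveLo-mono lo lo≤fl[u] (mono (fin≤fin u≤v)) , BelowHi-mono hi fl[w]≤hi (mono (fin≤fin v≤w)) , IsF̄-fl _

    feasible-via-∞ : ∀ {Z : ℚ̄ → Set} {x} → x ≢ 0ℚ → Z (fl -∞) ⊎ Z (fl +∞) → Feasible R Z (fin x)
    feasible-via-∞ {x = x} x≢0 Z∞ with signℚ x in sx | Z∞
    ... | neg | inj₁ Z-∞ = +∞ , tt , -∞ , cong infty sx , Z-∞
    ... | neg | inj₂ Z+∞ = -∞ , tt , +∞ , cong (infty ∘ flipS) sx , Z+∞
    ... | pos | inj₁ Z-∞ = -∞ , tt , -∞ , cong (infty ∘ flipS) sx , Z-∞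
    ... | pos | inj₂ Z+∞ = +∞ , tt , +∞ , cong infty sx , Z+∞
    ... | zer | _        = contradiction (signℚ≡zer⇒≡0 x sx) x≢0

    feasible-if-bracketed : ∀ {lo hi x z δ c} → x ≢ 0ℚ → FPInterval lo hi (fin z) →
                            FloatBracket (x ℚ.*_) δ z → δ ℚ.< c →
                            DiamGe (Preimage R (FPInterval lo hi)) c → Feasible R (FPInterval lo hi) (fin x)
    feasible-if-bracketed {lo} {hi} {x} {z} {δ} x≢0 z∈Z (y₁ , y₂ , F₁ , F₂ , xy₁≤z , z≤xy₂ , gap) δ<c diam =
      from-wide-pair (diam δ δ<c)
      where
      Z : ℚ̄ → Set
      Z = FPInterval lo hi
      via-∞ : Z (fl -∞) ⊎ Z (fl +∞) → Feasible R Z (fin x)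
      via-∞ = feasible-via-∞ {Z} x≢0
      feasible-at : ∀ y → IsF y → Preimage R Z (fin (x ℚ.* y)) → Feasible R Z (fin x)
      feasible-at y F Zxy = fin y , F , fin (x ℚ.* y) , refl , Zxy
      from-wide-pair : ∃[ a ] ∃[ b ] Preimage R Z a × Preimage R Z b × fin δ <̄ dist a b → Feasible R Z (fin x)
      from-wide-pair (-∞    , _     , Z-∞ , _   , _) = via-∞ (inj₁ Z-∞)
      from-wide-pair (+∞    , _     , Z+∞ , _   , _) = via-∞ (inj₂ Z+∞)
      from-wide-pair (fin _ , -∞    , _   , Z-∞ , _) = via-∞ (inj₁ Z-∞)
      from-wide-pair (fin _ , +∞    , _   , Z+∞ , _) = via-∞ (inj₂ Z+∞)
      from-wide-pair (fin a , fin b , Za  , Zb  , fin≤fin δ≤∣a-b∣ , δ≢∣a-b∣) =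
        [ feasible-at y₁ F₁ , feasible-at y₂ F₂ ]′
          (convex-bracket (Preimage-convex lo hi) (subst Z (sym (fl-fixed (proj₂ (proj₂ z∈Z)))) z∈Z)
                          xy₁≤z z≤xy₂ Za Zb (ℚP.≤-<-trans gap (≤∧≢⇒< δ≤∣a-b∣ (δ≢∣a-b∣ ∘ cong fin))))

mainTheorem11 : (fmt : Format) → let open FP fmt in
    (R : Rounding) (lo hi : Bound) (x z : ℚ) (e : ℤ) →
    IsF* x →
    FPInterval lo hi (fin z) →
    β^ (Format.emin fmt) ℚ.≤ ℚ.∣ z ÷? x ∣ →
    ℚ.∣ z ÷? x ∣ ℚ.≤ maxF →
    IsE z e →
    DiamGe (Preimage R (FPInterval lo hi)) (β^ (Qof e ℤ.+ (+ 1))) →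
    Feasible R (FPInterval lo hi) (fin x)
mainTheorem11 fmt R lo hi x z e x∈F* z∈Z β^emin≤∣s∣ ∣s∣≤maxF z∈E diam =
  let k , β^k≤∣s∣ , s-bracket = normal-bracket β^emin≤∣s∣ ∣s∣≤maxF
      z-bracket = subst (FloatBracket (x ℚ.*_) _) xs≡z (bracket-scale x (bracket-from-∣∣ s-bracket))
  in feasible-if-bracketed R x≢0 z∈Z z-bracket (∣x∣*ulp<β^[Q+1] x e β^k≤∣s∣ ∣xs∣<β^[e+1]) diam
  where
  open FP fmt
  open FPProperties fmt
  x≢0 : x ≢ 0ℚ
  x≢0 = IsF*⇒≢0 x∈F*
  xs≡z : x ℚ.* (z ÷? x) ≡ z
  xs≡z = x*[z÷?x]≡z z x≢0
  ∣xs∣<β^[e+1] : ℚ.∣ x ℚ.* (z ÷? x) ∣ ℚ.< β^ (e ℤ.+ + 1)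
  ∣xs∣<β^[e+1] = subst (λ w → ℚ.∣ w ∣ ℚ.< β^ (e ℤ.+ + 1)) (sym xs≡z) (IsE⇒∣x∣<β^[e+1] z∈E)
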